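{- Let $m$ be a positive even integer, and for $z\in\{0,1\}$ let $\mathcal G_z$ be the uniform distribution over $\{x\in\{0,1\}^m:\textsc{GapOr}(x)=z\}$. For every conjunction $C\colon\{0,1\}^m\to\{0,1\}$: (i) $C(\mathcal G_0)\in\{0,1\}$; (ii) if $C(\mathcal G_0)=1$ and $C$ has width $w\le m/4$, then $C(\mathcal G_1)\ge 3^{ -w}$.
   Context: $\textsc{GapOr}(x)=0$ if $|x|=0$ and $=1$ if $|x|=m/2$ (Hamming weight), undefined otherwise. A conjunction is an AND of literals (variables or negated variables); its width is its number of literals. For a distribution $\mathcal D$, $C(\mathcal D)=\Pr_{x\sim\mathcal D}[C(x)=1]$. -}

module Defs where

open import Data.Bool using (Bool; true; false; not; _∧_)
open import Data.Nat using (ℕ; zero; suc; _+_; _*_; _^_; _/_; _≟_)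
open import Data.Nat.Properties using (m^n≢0)
open import Data.Fin using (Fin)
open import Data.Vec using (Vec; []; _∷_; lookup)
open import Data.List using (List; []; _∷_; map; _++_; length; filter; concatMap)
open import Data.Maybe using (Maybe; just; nothing)
open import Data.Maybe.Properties using () renaming (≡-dec to ≡-decMaybe)
open import Data.Product using (_×_; _,_)
open import Data.Integer using (+_)
open import Data.Rational using (ℚ; 0ℚ) renaming (_/_ to _/ℚ_)
open import Relation.Binary.PropositionalEquality using (_≡_)
open import Relation.Nullary using (Dec; yes; no)
import Data.Bool.Properties as BoolP

allVecs : (m : ℕ) → List (Vec Bool m)
allVecs zero = [] ∷ []
allVecs (suc m) = map (false ∷_) (allVecs m) ++ map (true ∷_) (allVecs m)

weight : ∀ {m} → Vec Bool m → ℕ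
weight [] = 0
weight (false ∷ xs) = weight xs
weight (true ∷ xs) = suc (weight xs)

gapOr : ∀ {m} → Vec Bool m → Maybe Bool
gapOr {m} x with weight x ≟ 0
... | yes _ = just false
... | no _ with weight x ≟ m / 2
...   | yes _ = just true
...   | no _ = nothing

support : (m : ℕ) → Bool → List (Vec Bool m)
support m z = filter (λ x → ≡-decMaybe BoolP._≟_ (gapOr x) (just z)) (allVecs m)

Literal : ℕ → Set
Literal m = Fin m × Bool

Conjunction : ℕ → Set
Conjunction m = List (Literal m)

width : ∀ {m} → Conjunction m → ℕ
width = length

evalLit : ∀ {m} → Literal m → Vec Bool m → Bool
evalLit (i , true) x = lookup x i
evalLit (i , false) x = not (lookup x i)

evalConj : ∀ {m} → Conjunction m → Vec Bool m → Bool
evalConj [] x = true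
evalConj (l ∷ ls) x = evalLit l x ∧ evalConj ls x

-- Pr_{x ~ uniform(S)}[f x = 1]  (0 for an empty support, which never occurs here)
uniformProb : ∀ {m} → List (Vec Bool m) → (Vec Bool m → Bool) → ℚ
uniformProb S f with length S
... | zero = 0ℚ
... | suc n = (+ length (filter (λ x → f x BoolP.≟ true) S)) /ℚ suc n

acc : ∀ {m} → Conjunction m → Bool → ℚ
acc {m} C z = uniformProb (support m z) (evalConj C)

threeToMinus : ℕ → ℚ
threeToMinus w = _/ℚ_ (+ 1) (3 ^ w) {{m^n≢0 3 w}}

module Submission where

-- G₀ is the point mass at 0ᵐ, so C(G₀) = C(0ᵐ) ∈ {0,1}. If C(0ᵐ) = 1 then every literal of C is
-- negative, so C accepts exactly the x avoiding its set V of d ≤ w variables, and under G₁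
-- (uniform on the weight-h vectors, h = m/2) this has probability (m−d choose h)/(m choose h).
-- Putting the d variables back one at a time multiplies (f choose h) by (f+1)/(f+1−h), which is
-- at most 3 as long as f+1 ≥ 3h/2; this holds throughout because d ≤ m/4.

open import Defs
open import Data.Bool using (Bool; true; false; not; _∧_; if_then_else_)
open import Data.Bool.Properties as Bool using (∧-zeroʳ; ∧-assoc; ∧-comm)
open import Data.Fin using () renaming (zero to fzero; suc to fsuc)
import Data.Integer as ℤ
open import Data.Integer.Properties using (pos-*)
open import Data.List using (List; []; _∷_; _++_; map; length; filter)
open import Data.Maybe using (Maybe; just)
open import Data.Maybe.Properties using () renaming (≡-dec to ≡-decMaybe)
open import Data.Nat using (ℕ; zero; suc; _+_; _*_; _^_; _<_; _≤_; _/_; _≟_; NonZero; z≤n; s≤s)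
open import Data.Nat.Combinatorics using (nC1≡n; nCk+nC[k+1]≡[n+1]C[k+1]) renaming (_C_ to _choose_)
open import Data.Nat.DivMod using (m/n*n≡m; m/n*n≤m; m/n≤m)
open import Data.Nat.Divisibility using (_∣_)
open import Data.Nat.Properties
open import Data.Nat.Tactic.RingSolver using (solve-∀)
open import Data.Product using (_×_; _,_)
open import Data.Rational using (0ℚ; 1ℚ) renaming (_/_ to _/ℚ_; _≤_ to _≤ℚ_)
open import Data.Rational.Properties using (toℚᵘ-cancel-≤; toℚᵘ-fromℚᵘ)
import Data.Rational.Unnormalised as ℚᵘ
import Data.Rational.Unnormalised.Properties as ℚᵘ
open import Data.Sum using (_⊎_; inj₁; inj₂)
open import Data.Vec using (Vec; []; _∷_; lookup; replicate; _[_]≔_)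
open import Data.Vec.Properties using (lookup-replicate)
open import Relation.Binary.PropositionalEquality
open import Relation.Nullary using (does; yes; no)
open import Relation.Nullary.Decidable using (dec-true; dec-false)
open import Relation.Unary using (Decidable)
open import Relation.Binary.Definitions using (DecidableEquality)

countTrue : {A : Set} → (A → Bool) → List A → ℕ
countTrue f [] = 0
countTrue f (x ∷ xs) with f x
... | true = suc (countTrue f xs)
... | false = countTrue f xs

countTrue-++ : {A : Set} (f : A → Bool) (xs ys : List A) →
  countTrue f (xs ++ ys) ≡ countTrue f xs + countTrue f ys
countTrue-++ f [] ys = refl
countTrue-++ f (x ∷ xs) ys with f x
... | true = cong suc (countTrue-++ f xs ys)
... | false = countTrue-++ f xs ys

countTrue-map : {A B : Set} (f : B → Bool) (g : A → B) (xs : List A) →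
  countTrue f (map g xs) ≡ countTrue (λ x → f (g x)) xs
countTrue-map f g [] = refl
countTrue-map f g (x ∷ xs) with f (g x)
... | true = cong suc (countTrue-map f g xs)
... | false = countTrue-map f g xs

countTrue-cong : {A : Set} {f g : A → Bool} → (∀ x → f x ≡ g x) → (xs : List A) →
  countTrue f xs ≡ countTrue g xs
countTrue-cong f≗g [] = refl
countTrue-cong {f = f} {g} f≗g (x ∷ xs) with f x | g x | f≗g x
... | true | .true | refl = cong suc (countTrue-cong f≗g xs)
... | false | .false | refl = countTrue-cong f≗g xs

countTrue-false : {A : Set} (xs : List A) → countTrue (λ _ → false) xs ≡ 0
countTrue-false [] = refl
countTrue-false (x ∷ xs) = countTrue-false xs

countTrue-true : {A : Set} (xs : List A) → countTrue (λ _ → true) xs ≡ length xs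
countTrue-true [] = refl
countTrue-true (x ∷ xs) = cong suc (countTrue-true xs)

countTrue-filter : ∀ {A : Set} {p} {P : A → Set p} (P? : Decidable P) (f : A → Bool) (xs : List A) →
  countTrue f (filter P? xs) ≡ countTrue (λ x → does (P? x) ∧ f x) xs
countTrue-filter P? f [] = refl
countTrue-filter P? f (x ∷ xs) with does (P? x)
... | false = countTrue-filter P? f xs
... | true with f x
...   | true = cong suc (countTrue-filter P? f xs)
...   | false = countTrue-filter P? f xs

length-filter-≟true : {A : Set} (f : A → Bool) (xs : List A) →
  length (filter (λ x → f x Bool.≟ true) xs) ≡ countTrue f xs
length-filter-≟true f [] = refl
length-filter-≟true f (x ∷ xs) with f x
... | true = cong suc (length-filter-≟true f xs)
... | false = length-filter-≟true f xs

countTrue-allVecs-suc : ∀ m (f : Vec Bool (suc m) → Bool) →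
  countTrue f (allVecs (suc m)) ≡
    countTrue (λ y → f (false ∷ y)) (allVecs m) + countTrue (λ y → f (true ∷ y)) (allVecs m)
countTrue-allVecs-suc m f = begin
  countTrue f (map (false ∷_) (allVecs m) ++ map (true ∷_) (allVecs m))
    ≡⟨ countTrue-++ f (map (false ∷_) (allVecs m)) _ ⟩
  countTrue f (map (false ∷_) (allVecs m)) + countTrue f (map (true ∷_) (allVecs m))
    ≡⟨ cong₂ _+_ (countTrue-map f (false ∷_) (allVecs m)) (countTrue-map f (true ∷_) (allVecs m)) ⟩
  countTrue (λ y → f (false ∷ y)) (allVecs m) + countTrue (λ y → f (true ∷ y)) (allVecs m) ∎
  where open ≡-Reasoning

zeros : ∀ {m} → Vec Bool m → ℕ
zeros [] = 0
zeros (true ∷ z) = zeros z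
zeros (false ∷ z) = suc (zeros z)

zeros+weight : ∀ {m} (z : Vec Bool m) → zeros z + weight z ≡ m
zeros+weight [] = refl
zeros+weight (true ∷ z) = trans (+-suc (zeros z) (weight z)) (cong suc (zeros+weight z))
zeros+weight (false ∷ z) = cong suc (zeros+weight z)

zeros-replicate-false : ∀ m → zeros (replicate m false) ≡ m
zeros-replicate-false zero = refl
zeros-replicate-false (suc m) = cong suc (zeros-replicate-false m)

weight-replicate-false : ∀ m → weight (replicate m false) ≡ 0
weight-replicate-false zero = refl
weight-replicate-false (suc m) = weight-replicate-false m

weight-[]≔true : ∀ {m} (z : Vec Bool m) i → weight (z [ i ]≔ true) ≤ suc (weight z)
weight-[]≔true (true ∷ z) fzero = n≤1+n _
weight-[]≔true (false ∷ z) fzero = ≤-refl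
weight-[]≔true (true ∷ z) (fsuc i) = s≤s (weight-[]≔true z i)
weight-[]≔true (false ∷ z) (fsuc i) = weight-[]≔true z i

disjoint : ∀ {m} → Vec Bool m → Vec Bool m → Bool
disjoint [] [] = true
disjoint (a ∷ x) (b ∷ z) = not (a ∧ b) ∧ disjoint x z

disjoint-replicate-false : ∀ {m} (x : Vec Bool m) → disjoint x (replicate m false) ≡ true
disjoint-replicate-false [] = refl
disjoint-replicate-false (a ∷ x) rewrite ∧-zeroʳ a = disjoint-replicate-false x

disjoint-[]≔true : ∀ {m} (x z : Vec Bool m) i →
  disjoint x (z [ i ]≔ true) ≡ not (lookup x i) ∧ disjoint x z
disjoint-[]≔true (true ∷ x) (b ∷ z) fzero = refl
disjoint-[]≔true (false ∷ x) (b ∷ z) fzero = refl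
disjoint-[]≔true (a ∷ x) (b ∷ z) (fsuc i) = begin
  not (a ∧ b) ∧ disjoint x (z [ i ]≔ true)      ≡⟨ cong (not (a ∧ b) ∧_) (disjoint-[]≔true x z i) ⟩
  not (a ∧ b) ∧ (not (lookup x i) ∧ disjoint x z) ≡⟨ ∧-assoc (not (a ∧ b)) _ _ ⟨
  (not (a ∧ b) ∧ not (lookup x i)) ∧ disjoint x z ≡⟨ cong (_∧ disjoint x z) (∧-comm (not (a ∧ b)) _) ⟩
  (not (lookup x i) ∧ not (a ∧ b)) ∧ disjoint x z ≡⟨ ∧-assoc (not (lookup x i)) _ _ ⟩
  not (lookup x i) ∧ (not (a ∧ b) ∧ disjoint x z) ∎
  where open ≡-Reasoning

countTrue-weight≡0 : ∀ m (f : Vec Bool m → Bool) →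
  countTrue (λ x → does (weight x ≟ 0) ∧ f x) (allVecs m) ≡ (if f (replicate m false) then 1 else 0)
countTrue-weight≡0 zero f with f []
... | true = refl
... | false = refl
countTrue-weight≡0 (suc m) f = begin
  countTrue (λ x → does (weight x ≟ 0) ∧ f x) (allVecs (suc m))
    ≡⟨ countTrue-allVecs-suc m _ ⟩
  countTrue (λ y → does (weight y ≟ 0) ∧ f (false ∷ y)) (allVecs m) + countTrue (λ _ → false) (allVecs m)
    ≡⟨ cong₂ _+_ (countTrue-weight≡0 m (λ y → f (false ∷ y))) (countTrue-false (allVecs m)) ⟩
  (if f (replicate (suc m) false) then 1 else 0) + 0
    ≡⟨ +-identityʳ _ ⟩
  (if f (replicate (suc m) false) then 1 else 0) ∎
  where open ≡-Reasoning

countTrue-weight≡k-disjoint : ∀ m (z : Vec Bool m) k →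
  countTrue (λ x → does (weight x ≟ k) ∧ disjoint x z) (allVecs m) ≡ zeros z choose k
countTrue-weight≡k-disjoint zero [] zero = refl
countTrue-weight≡k-disjoint zero [] (suc k) = refl
countTrue-weight≡k-disjoint (suc m) (b ∷ z) k = begin
  countTrue (λ x → does (weight x ≟ k) ∧ disjoint x (b ∷ z)) (allVecs (suc m))
    ≡⟨ countTrue-allVecs-suc m _ ⟩
  countTrue (λ y → does (weight y ≟ k) ∧ disjoint y z) (allVecs m) + countHeadTrue b k
    ≡⟨ cong (_+ countHeadTrue b k) (countTrue-weight≡k-disjoint m z k) ⟩
  zeros z choose k + countHeadTrue b k
    ≡⟨ pascal b k ⟩
  zeros (b ∷ z) choose k ∎
  where
  open ≡-Reasoning
  countHeadTrue : Bool → ℕ → ℕ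
  countHeadTrue b k = countTrue (λ y → does (suc (weight y) ≟ k) ∧ (not b ∧ disjoint y z)) (allVecs m)
  pascal : ∀ b k → zeros z choose k + countHeadTrue b k ≡ zeros (b ∷ z) choose k
  pascal true k = begin
    zeros z choose k + countHeadTrue true k
      ≡⟨ cong (λ n → zeros z choose k + n) (countTrue-cong (λ y → ∧-zeroʳ _) (allVecs m)) ⟩
    zeros z choose k + countTrue (λ _ → false) (allVecs m)
      ≡⟨ cong (λ n → zeros z choose k + n) (countTrue-false (allVecs m)) ⟩
    zeros z choose k + 0
      ≡⟨ +-identityʳ _ ⟩
    zeros z choose k ∎
  pascal false zero = cong (1 +_) (countTrue-false (allVecs m))
  pascal false (suc k) = begin
    zeros z choose suc k + countHeadTrue false (suc k)
      ≡⟨ cong (λ n → zeros z choose suc k + n) (countTrue-weight≡k-disjoint m z k) ⟩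
    zeros z choose suc k + zeros z choose k
      ≡⟨ +-comm (zeros z choose suc k) _ ⟩
    zeros z choose k + zeros z choose suc k
      ≡⟨ nCk+nC[k+1]≡[n+1]C[k+1] (zeros z) k ⟩
    suc (zeros z) choose suc k ∎

variables : ∀ {m} → Conjunction m → Vec Bool m
variables {m} [] = replicate m false
variables ((i , _) ∷ C) = variables C [ i ]≔ true

weight-variables≤width : ∀ {m} (C : Conjunction m) → weight (variables C) ≤ width C
weight-variables≤width {m} [] = ≤-reflexive (weight-replicate-false m)
weight-variables≤width ((i , _) ∷ C) =
  ≤-trans (weight-[]≔true (variables C) i) (s≤s (weight-variables≤width C))

evalConj≡disjoint-variables : ∀ {m} (C : Conjunction m) → evalConj C (replicate m false) ≡ true →
  ∀ x → evalConj C x ≡ disjoint x (variables C)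
evalConj≡disjoint-variables [] _ x = sym (disjoint-replicate-false x)
evalConj≡disjoint-variables {m} ((i , true) ∷ C) C0≡true x
  rewrite lookup-replicate i false with () ← C0≡true
evalConj≡disjoint-variables {m} ((i , false) ∷ C) C0≡true x rewrite lookup-replicate i false = begin
  not (lookup x i) ∧ evalConj C x
    ≡⟨ cong (not (lookup x i) ∧_) (evalConj≡disjoint-variables C C0≡true x) ⟩
  not (lookup x i) ∧ disjoint x (variables C)
    ≡⟨ disjoint-[]≔true x (variables C) i ⟨
  disjoint x (variables C [ i ]≔ true) ∎
  where open ≡-Reasoning

nCk>0 : ∀ {n k} → k ≤ n → 0 < n choose k
nCk>0 {n} {zero} _ = s≤s z≤n
nCk>0 {suc n} {suc k} (s≤s k≤n) = begin-strict
  0                              <⟨ nCk>0 k≤n ⟩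
  n choose k                     ≤⟨ m≤m+n (n choose k) _ ⟩
  n choose k + n choose suc k    ≡⟨ nCk+nC[k+1]≡[n+1]C[k+1] n k ⟩
  suc n choose suc k             ∎
  where open ≤-Reasoning

[n+1]C[k+1]*[k+1]≡nCk*[n+1] : ∀ n k → (suc n choose suc k) * suc k ≡ (n choose k) * suc n
[n+1]C[k+1]*[k+1]≡nCk*[n+1] zero zero = refl
[n+1]C[k+1]*[k+1]≡nCk*[n+1] zero (suc k) = refl
[n+1]C[k+1]*[k+1]≡nCk*[n+1] (suc n) zero = begin
  (suc (suc n) choose 1) * 1  ≡⟨ *-identityʳ _ ⟩
  suc (suc n) choose 1        ≡⟨ nC1≡n (suc (suc n)) ⟩
  suc (suc n)                 ≡⟨ *-identityˡ _ ⟨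
  1 * suc (suc n)             ∎
  where open ≡-Reasoning
[n+1]C[k+1]*[k+1]≡nCk*[n+1] (suc n) (suc k) = begin
  (suc (suc n) choose suc (suc k)) * (2 + k)
      ≡⟨ cong (_* (2 + k)) (nCk+nC[k+1]≡[n+1]C[k+1] (suc n) (suc k)) ⟨
  (P + X) * (2 + k)              ≡⟨ split-last-factor P X k ⟩
  P * (1 + k) + P + X * (2 + k)  ≡⟨ cong₂ (λ u v → u + P + v) (absorb n k) (absorb n (suc k)) ⟩
  a * (1 + n) + P + b * (1 + n)  ≡⟨ cong (λ u → a * (1 + n) + u + b * (1 + n)) pascal ⟨
  a * (1 + n) + (a + b) + b * (1 + n)  ≡⟨ collect a b n ⟩
  (a + b) * (2 + n)              ≡⟨ cong (_* (2 + n)) pascal ⟩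
  P * (2 + n)                    ∎
  where
  open ≡-Reasoning
  absorb : ∀ n k → (suc n choose suc k) * suc k ≡ (n choose k) * suc n
  absorb = [n+1]C[k+1]*[k+1]≡nCk*[n+1]
  a b P X : ℕ
  a = n choose k
  b = n choose suc k
  P = suc n choose suc k
  X = suc n choose suc (suc k)
  pascal : a + b ≡ P
  pascal = nCk+nC[k+1]≡[n+1]C[k+1] n k
  split-last-factor : ∀ P X k → (P + X) * (2 + k) ≡ P * (1 + k) + P + X * (2 + k)
  split-last-factor = solve-∀
  collect : ∀ a b n → a * (1 + n) + (a + b) + b * (1 + n) ≡ (a + b) * (2 + n)
  collect = solve-∀

nCk≤2*nC[k+1] : ∀ n k → 3 * suc k ≤ 2 * suc n → n choose k ≤ 2 * (n choose suc k)
nCk≤2*nC[k+1] n k 3[k+1]≤2[n+1] = *-cancelʳ-≤ Y (2 * X) (suc k) (begin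
  Y * suc k                  ≤⟨ +-cancelʳ-≤ (2 * (Y * suc k)) _ _ key ⟩
  2 * (X * suc k)            ≡⟨ *-assoc 2 X (suc k) ⟨
  2 * X * suc k              ∎)
  where
  open ≤-Reasoning
  Y X : ℕ
  Y = n choose k
  X = n choose suc k
  key : Y * suc k + 2 * (Y * suc k) ≤ 2 * (X * suc k) + 2 * (Y * suc k)
  key = begin
    Y * suc k + 2 * (Y * suc k)        ≡⟨ triple Y (suc k) ⟩
    Y * (3 * suc k)                    ≤⟨ *-monoʳ-≤ Y 3[k+1]≤2[n+1] ⟩
    Y * (2 * suc n)                    ≡⟨ swap-2 Y (suc n) ⟩
    2 * (Y * suc n)                    ≡⟨ cong (2 *_) ([n+1]C[k+1]*[k+1]≡nCk*[n+1] n k) ⟨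
    2 * ((suc n choose suc k) * suc k) ≡⟨ cong (λ P → 2 * (P * suc k)) (nCk+nC[k+1]≡[n+1]C[k+1] n k) ⟨
    2 * ((Y + X) * suc k)              ≡⟨ expand Y X (suc k) ⟩
    2 * (X * suc k) + 2 * (Y * suc k)  ∎
    where
    triple : ∀ Y s → Y * s + 2 * (Y * s) ≡ Y * (3 * s)
    triple = solve-∀
    swap-2 : ∀ Y n → Y * (2 * n) ≡ 2 * (Y * n)
    swap-2 = solve-∀
    expand : ∀ Y X s → 2 * ((Y + X) * s) ≡ 2 * (X * s) + 2 * (Y * s)
    expand = solve-∀

[n+1]C[k+1]≤3*nC[k+1] : ∀ n k → 3 * suc k ≤ 2 * suc n → suc n choose suc k ≤ 3 * (n choose suc k)
[n+1]C[k+1]≤3*nC[k+1] n k 3[k+1]≤2[n+1] = begin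
  suc n choose suc k               ≡⟨ nCk+nC[k+1]≡[n+1]C[k+1] n k ⟨
  n choose k + n choose suc k      ≡⟨ +-comm (n choose k) _ ⟩
  n choose suc k + n choose k      ≤⟨ +-monoʳ-≤ (n choose suc k) (nCk≤2*nC[k+1] n k 3[k+1]≤2[n+1]) ⟩
  n choose suc k + 2 * (n choose suc k)  ∎
  where open ≤-Reasoning

3h≤2[f+1] : ∀ h d f → f + suc d ≡ h + h → 4 * suc d ≤ h + h → 3 * h ≤ 2 * suc f
3h≤2[f+1] h d f f+d+1≡2h 4[d+1]≤2h = +-cancelʳ-≤ (2 * d) (3 * h) (2 * suc f) (begin
  3 * h + 2 * d       ≤⟨ +-monoʳ-≤ (3 * h) 2d≤h ⟩
  3 * h + h           ≡⟨ 3h+h≡2[h+h] h ⟩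
  2 * (h + h)         ≡⟨ cong (2 *_) f+d+1≡2h ⟨
  2 * (f + suc d)     ≡⟨ distribute f d ⟩
  2 * suc f + 2 * d   ∎)
  where
  open ≤-Reasoning
  3h+h≡2[h+h] : ∀ h → 3 * h + h ≡ 2 * (h + h)
  3h+h≡2[h+h] = solve-∀
  distribute : ∀ f d → 2 * (f + suc d) ≡ 2 * suc f + 2 * d
  distribute = solve-∀
  four-times : ∀ d → 2 * (2 * d) + 4 ≡ 4 * suc d
  four-times = solve-∀
  2d≤h : 2 * d ≤ h
  2d≤h = *-cancelˡ-≤ 2 (begin
    2 * (2 * d)      ≤⟨ m≤m+n _ 4 ⟩
    2 * (2 * d) + 4  ≡⟨ four-times d ⟩
    4 * suc d        ≤⟨ 4[d+1]≤2h ⟩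
    h + h            ≡⟨ cong (h +_) (+-identityʳ h) ⟨
    2 * h            ∎)

[h+h]Ch≤3^d*fCh : ∀ h d f → f + d ≡ h + h → 4 * d ≤ h + h →
  (h + h) choose h ≤ 3 ^ d * (f choose h)
[h+h]Ch≤3^d*fCh h zero f f+0≡2h _ = begin
  (h + h) choose h        ≡⟨ cong (_choose h) (trans (sym f+0≡2h) (+-identityʳ f)) ⟩
  f choose h              ≡⟨ *-identityˡ _ ⟨
  1 * (f choose h)        ∎
  where open ≤-Reasoning
[h+h]Ch≤3^d*fCh zero (suc d) f _ ()
[h+h]Ch≤3^d*fCh h@(suc k) (suc d) f f+d+1≡2h 4[d+1]≤2h = begin
  (h + h) choose h            ≤⟨ [h+h]Ch≤3^d*fCh h d (suc f) (trans (sym (+-suc f d)) f+d+1≡2h)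
                                   (≤-trans (*-monoʳ-≤ 4 (n≤1+n d)) 4[d+1]≤2h) ⟩
  3 ^ d * (suc f choose h)    ≤⟨ *-monoʳ-≤ (3 ^ d) ([n+1]C[k+1]≤3*nC[k+1] f k
                                   (3h≤2[f+1] h d f f+d+1≡2h 4[d+1]≤2h)) ⟩
  3 ^ d * (3 * (f choose h))  ≡⟨ reassociate (3 ^ d) (f choose h) ⟩
  3 * 3 ^ d * (f choose h)    ∎
  where
  open ≤-Reasoning
  reassociate : ∀ a b → a * (3 * b) ≡ 3 * a * b
  reassociate = solve-∀

+a/b≤+c/d : ∀ a b c d .{{_ : NonZero b}} .{{_ : NonZero d}} →
  a * d ≤ c * b → (ℤ.+ a) /ℚ b ≤ℚ (ℤ.+ c) /ℚ d
+a/b≤+c/d a (suc b) c (suc d) ad≤cb = toℚᵘ-cancel-≤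
  (ℚᵘ.≤-respˡ-≃ (ℚᵘ.≃-sym (toℚᵘ-fromℚᵘ (ℚᵘ.mkℚᵘ (ℤ.+ a) b)))
  (ℚᵘ.≤-respʳ-≃ (ℚᵘ.≃-sym (toℚᵘ-fromℚᵘ (ℚᵘ.mkℚᵘ (ℤ.+ c) d)))
    (ℚᵘ.*≤* (subst₂ ℤ._≤_ (pos-* a (suc d)) (pos-* c (suc b)) (ℤ.+≤+ ad≤cb)))))

uniformProb≡ : ∀ {m} (S : List (Vec Bool m)) f {n c} → length S ≡ suc n → countTrue f S ≡ c →
  uniformProb S f ≡ (ℤ.+ c) /ℚ suc n
uniformProb≡ S f |S|≡1+n #f≡c with length S | |S|≡1+n
... | _ | refl = cong (λ k → (ℤ.+ k) /ℚ _) (trans (length-filter-≟true f S) #f≡c)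

threeToMinus≤uniformProb : ∀ {m} (S : List (Vec Bool m)) f w {B c} →
  length S ≡ B → countTrue f S ≡ c →
  0 < B → B ≤ c * 3 ^ w → threeToMinus w ≤ℚ uniformProb S f
threeToMinus≤uniformProb S f w {suc n} {c} |S|≡B #f≡c _ B≤c3ʷ =
  subst (threeToMinus w ≤ℚ_) (sym (uniformProb≡ S f |S|≡B #f≡c))
    (+a/b≤+c/d 1 (3 ^ w) c (suc n) {{m^n≢0 3 w}}
      (subst (_≤ c * 3 ^ w) (sym (*-identityˡ (suc n))) B≤c3ʷ))

_≟ᴹ_ : DecidableEquality (Maybe Bool)
_≟ᴹ_ = ≡-decMaybe Bool._≟_

gapOr≟just-false : ∀ {m} (x : Vec Bool m) → does (gapOr x ≟ᴹ just false) ≡ does (weight x ≟ 0)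
gapOr≟just-false {m} x with weight x ≟ 0
... | yes w≡0 = sym (dec-true (weight x ≟ 0) w≡0)
... | no w≢0 with weight x ≟ m / 2
...   | yes _ = sym (dec-false (weight x ≟ 0) w≢0)
...   | no _ = sym (dec-false (weight x ≟ 0) w≢0)

gapOr≟just-true : ∀ {m} → m / 2 ≢ 0 → (x : Vec Bool m) →
  does (gapOr x ≟ᴹ just true) ≡ does (weight x ≟ m / 2)
gapOr≟just-true {m} h≢0 x with weight x ≟ 0
... | yes w≡0 = sym (dec-false (weight x ≟ m / 2) (λ w≡h → h≢0 (trans (sym w≡h) w≡0)))
... | no _ with weight x ≟ m / 2
...   | yes w≡h = sym (dec-true (weight x ≟ m / 2) w≡h)
...   | no w≢h = sym (dec-false (weight x ≟ m / 2) w≢h)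

countTrue-support-false : ∀ m (g : Vec Bool m → Bool) →
  countTrue g (support m false) ≡ (if g (replicate m false) then 1 else 0)
countTrue-support-false m g = begin
  countTrue g (support m false)
    ≡⟨ countTrue-filter _ g (allVecs m) ⟩
  countTrue (λ x → does (gapOr x ≟ᴹ just false) ∧ g x) (allVecs m)
    ≡⟨ countTrue-cong (λ x → cong (_∧ g x) (gapOr≟just-false x)) (allVecs m) ⟩
  countTrue (λ x → does (weight x ≟ 0) ∧ g x) (allVecs m)
    ≡⟨ countTrue-weight≡0 m g ⟩
  (if g (replicate m false) then 1 else 0) ∎
  where open ≡-Reasoning

countTrue-disjoint-support-true : ∀ m → m / 2 ≢ 0 → (z : Vec Bool m) →
  countTrue (λ x → disjoint x z) (support m true) ≡ zeros z choose (m / 2)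
countTrue-disjoint-support-true m h≢0 z = begin
  countTrue (λ x → disjoint x z) (support m true)
    ≡⟨ countTrue-filter _ _ (allVecs m) ⟩
  countTrue (λ x → does (gapOr x ≟ᴹ just true) ∧ disjoint x z) (allVecs m)
    ≡⟨ countTrue-cong (λ x → cong (_∧ disjoint x z) (gapOr≟just-true h≢0 x)) (allVecs m) ⟩
  countTrue (λ x → does (weight x ≟ m / 2) ∧ disjoint x z) (allVecs m)
    ≡⟨ countTrue-weight≡k-disjoint m z (m / 2) ⟩
  zeros z choose (m / 2) ∎
  where open ≡-Reasoning

length-support-true : ∀ m → m / 2 ≢ 0 → length (support m true) ≡ m choose (m / 2)
length-support-true m h≢0 = begin
  length (support m true)
    ≡⟨ countTrue-true (support m true) ⟨
  countTrue (λ _ → true) (support m true)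
    ≡⟨ countTrue-cong (λ x → sym (disjoint-replicate-false x)) (support m true) ⟩
  countTrue (λ x → disjoint x (replicate m false)) (support m true)
    ≡⟨ countTrue-disjoint-support-true m h≢0 (replicate m false) ⟩
  zeros (replicate m false) choose (m / 2)
    ≡⟨ cong (_choose (m / 2)) (zeros-replicate-false m) ⟩
  m choose (m / 2) ∎
  where open ≡-Reasoning

2∣m⇒m≡m/2+m/2 : ∀ {m} → 2 ∣ m → m ≡ m / 2 + m / 2
2∣m⇒m≡m/2+m/2 {m} 2∣m = begin
  m                    ≡⟨ m/n*n≡m 2∣m ⟨
  m / 2 * 2            ≡⟨ *-comm (m / 2) 2 ⟩
  m / 2 + (m / 2 + 0)  ≡⟨ cong (m / 2 +_) (+-identityʳ (m / 2)) ⟩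
  m / 2 + m / 2        ∎
  where open ≡-Reasoning

n≤m/k⇒k*n≤m : ∀ {n} m k .{{_ : NonZero k}} → n ≤ m / k → k * n ≤ m
n≤m/k⇒k*n≤m {n} m k n≤m/k = begin
  k * n        ≤⟨ *-monoʳ-≤ k n≤m/k ⟩
  k * (m / k)  ≡⟨ *-comm k (m / k) ⟩
  m / k * k    ≤⟨ m/n*n≤m m k ⟩
  m            ∎
  where open ≤-Reasoning

acc-false≡ : ∀ {m} (C : Conjunction m) →
  acc C false ≡ (ℤ.+ (if evalConj C (replicate m false) then 1 else 0)) /ℚ 1
acc-false≡ {m} C = uniformProb≡ (support m false) (evalConj C)
  (trans (sym (countTrue-true (support m false))) (countTrue-support-false m (λ _ → true)))
  (countTrue-support-false m (evalConj C))

acc-false∈0,1 : ∀ {m} (C : Conjunction m) → acc C false ≡ 0ℚ ⊎ acc C false ≡ 1ℚ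
acc-false∈0,1 {m} C with evalConj C (replicate m false) | acc-false≡ C
... | false | acc≡0 = inj₁ acc≡0
... | true | acc≡1 = inj₂ acc≡1

acc-false≡1⇒evalConj-0≡true : ∀ {m} (C : Conjunction m) →
  acc C false ≡ 1ℚ → evalConj C (replicate m false) ≡ true
acc-false≡1⇒evalConj-0≡true {m} C acc≡1 with evalConj C (replicate m false) | acc-false≡ C
... | true | _ = refl
... | false | acc≡0 with () ← trans (sym acc≡0) acc≡1

threeToMinus-width≤acc-true : ∀ {m} (C : Conjunction m) → m ≡ m / 2 + m / 2 → 0 < m →
  evalConj C (replicate m false) ≡ true → 4 * width C ≤ m → threeToMinus (width C) ≤ℚ acc C true
threeToMinus-width≤acc-true {m} C m≡h+h 0<m C0≡true 4w≤m =
  threeToMinus≤uniformProb (support m true) (evalConj C) w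
  (length-support-true m h≢0)
  (trans (countTrue-cong (evalConj≡disjoint-variables C C0≡true) (support m true))
         (countTrue-disjoint-support-true m h≢0 V))
  (nCk>0 (m/n≤m m 2))
  (begin
    m choose h                         ≡⟨ cong (_choose h) m≡h+h ⟩
    (h + h) choose h                   ≤⟨ [h+h]Ch≤3^d*fCh h (weight V) (zeros V)
                                            (trans (zeros+weight V) m≡h+h) 4d≤h+h ⟩
    3 ^ weight V * (zeros V choose h)  ≤⟨ *-monoˡ-≤ (zeros V choose h) (^-monoʳ-≤ 3 d≤w) ⟩
    3 ^ w * (zeros V choose h)         ≡⟨ *-comm (3 ^ w) _ ⟩
    (zeros V choose h) * 3 ^ w         ∎)
  where
  open ≤-Reasoning
  h w : ℕ
  h = m / 2
  w = width C
  V : Vec Bool m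
  V = variables C
  d≤w : weight V ≤ w
  d≤w = weight-variables≤width C
  h≢0 : h ≢ 0
  h≢0 h≡0 = <-irrefl (sym (trans m≡h+h (cong₂ _+_ h≡0 h≡0))) 0<m
  4d≤h+h : 4 * weight V ≤ h + h
  4d≤h+h = begin
    4 * weight V  ≤⟨ *-monoʳ-≤ 4 d≤w ⟩
    4 * w         ≤⟨ 4w≤m ⟩
    m             ≡⟨ m≡h+h ⟩
    h + h         ∎

fact9 : (m : ℕ) → 0 < m → 2 ∣ m → (C : Conjunction m) →
    ((acc C false ≡ 0ℚ ⊎ acc C false ≡ 1ℚ)
    × (acc C false ≡ 1ℚ → width C ≤ m / 4 → threeToMinus (width C) ≤ℚ acc C true))
fact9 m 0<m 2∣m C = acc-false∈0,1 C , λ acc≡1 w≤m/4 →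
  threeToMinus-width≤acc-true C (2∣m⇒m≡m/2+m/2 2∣m) 0<m
    (acc-false≡1⇒evalConj-0≡true C acc≡1) (n≤m/k⇒k*n≤m m 4 w≤m/4)
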